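{- Let $D$ and $E$ be $\mathcal V$-dcpos equipped with specified small bases, and suppose $E$ has suprema of all (not necessarily directed) families indexed by types in $\mathcal V$. Then the exponential $E^D$ has a specified small basis.
   Context: Setting: intensional Martin-Löf type theory with universes, function extensionality, propositional extensionality and propositional truncations. A $\mathcal V$-dcpo is a poset (proposition-valued reflexive transitive antisymmetric order) in which every directed family (inhabited index type, any two indices have an upper bound index, with truncated existence) indexed by a type in $\mathcal V$ has a supremum; Scott continuous maps preserve these suprema. For $x,y:D$, $x\ll y$ (way below) if for every directed $\alpha:I\to D$ with $I:\mathcal V$ and $y\sqsubseteq\bigsqcup\alpha$ there exists $i$ with $x\sqsubseteq\alpha_i$. A small basis for $D$ is a map $\beta:B\to D$ with $B:\mathcal V$ such that each proposition $\beta(b)\ll x$ is $\mathcal V$-small (equivalent to a type in $\mathcal V$) and for every $x:D$ the family $\Sigma_{b:B}(\beta(b)\ll x)\to D$, $(b,\_)\mapsto\beta(b)$, is directed with supremum $x$. The exponential $E^D$ is the $\mathcal V$-dcpo of Scott continuous maps $D\to E$ ordered pointwise. -}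

module Defs where

open import Level using (Level; _⊔_; Lift; lift; lower; Setω) renaming (suc to lsuc)
open import Data.Product using (Σ; _×_; _,_; proj₁; proj₂)
open import Relation.Binary.PropositionalEquality using (_≡_; refl; subst)
open import Axiom.Extensionality.Propositional using (Extensionality)

isProp : ∀ {ℓ} → Set ℓ → Set ℓ
isProp A = (x y : A) → x ≡ y

FunExt : Setω
FunExt = ∀ {a b} → Extensionality a b

PropExt : Setω
PropExt = ∀ {ℓ} {P Q : Set ℓ} → isProp P → isProp Q → (P → Q) → (Q → P) → P ≡ Q

record PropTrunc : Setω where
  field
    ∥_∥ : ∀ {ℓ} → Set ℓ → Set ℓ
    ∥∥-isProp : ∀ {ℓ} {A : Set ℓ} → isProp ∥ A ∥
    ∣_∣ : ∀ {ℓ} {A : Set ℓ} → A → ∥ A ∥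
    ∥∥-rec : ∀ {ℓ ℓ'} {A : Set ℓ} {P : Set ℓ'} → isProp P → (A → P) → ∥ A ∥ → P

record isEquiv {a b} {A : Set a} {B : Set b} (f : A → B) : Set (a ⊔ b) where
  field
    sec : B → A
    sec-eq : ∀ y → f (sec y) ≡ y
    ret : B → A
    ret-eq : ∀ x → ret (f x) ≡ x

_≃_ : ∀ {a b} → Set a → Set b → Set (a ⊔ b)
A ≃ B = Σ (A → B) isEquiv

isSmall : (𝓥 : Level) {ℓ : Level} → Set ℓ → Set (lsuc 𝓥 ⊔ ℓ)
isSmall 𝓥 X = Σ (Set 𝓥) (λ Y → Y ≃ X)

isProp-Π : FunExt → ∀ {a b} {A : Set a} {B : A → Set b}
         → (∀ x → isProp (B x)) → isProp ((x : A) → B x)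
isProp-Π fe h f g = fe (λ x → h x (f x) (g x))

isProp-× : ∀ {a b} {A : Set a} {B : Set b} → isProp A → isProp B → isProp (A × B)
isProp-× pA pB (a , b) (a' , b') with pA a a' | pB b b'
... | refl | refl = refl

Σ-≡ : ∀ {a b} {A : Set a} {P : A → Set b} {x y : A} {p : P x} {q : P y}
    → (e : x ≡ y) → subst P e p ≡ q → (x , p) ≡ (y , q)
Σ-≡ refl refl = refl

module DomainTheory (pt : PropTrunc) where
  open PropTrunc pt

  ∥∥-map : ∀ {a b} {A : Set a} {B : Set b} → (A → B) → ∥ A ∥ → ∥ B ∥
  ∥∥-map f = ∥∥-rec ∥∥-isProp (λ a → ∣ f a ∣)

  module _ {𝓤 𝓣 : Level} {X : Set 𝓤} (_⊑_ : X → X → Set 𝓣) where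

    isSemidirected : ∀ {i} {I : Set i} → (I → X) → Set (i ⊔ 𝓣)
    isSemidirected {I = I} α =
      (i j : I) → ∥ Σ I (λ k → (α i ⊑ α k) × (α j ⊑ α k)) ∥

    isDirected : ∀ {i} {I : Set i} → (I → X) → Set (i ⊔ 𝓣)
    isDirected {I = I} α = ∥ I ∥ × isSemidirected α

    isUpperBound : ∀ {i} {I : Set i} → (I → X) → X → Set (i ⊔ 𝓣)
    isUpperBound {I = I} α u = (i : I) → α i ⊑ u

    isSup : ∀ {i} {I : Set i} → (I → X) → X → Set (i ⊔ 𝓤 ⊔ 𝓣)
    isSup α s = isUpperBound α s × ((u : X) → isUpperBound α u → s ⊑ u)

  record DCPO (𝓥 𝓤 𝓣 : Level) : Set (lsuc (𝓥 ⊔ 𝓤 ⊔ 𝓣)) where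
    field
      Carrier : Set 𝓤
      _⊑_ : Carrier → Carrier → Set 𝓣
      ⊑-prop : (x y : Carrier) → isProp (x ⊑ y)
      ⊑-refl : (x : Carrier) → x ⊑ x
      ⊑-trans : {x y z : Carrier} → x ⊑ y → y ⊑ z → x ⊑ z
      ⊑-antisym : {x y : Carrier} → x ⊑ y → y ⊑ x → x ≡ y
      ∐ : {I : Set 𝓥} (α : I → Carrier) → isDirected _⊑_ α → Carrier
      ∐-isSup : {I : Set 𝓥} (α : I → Carrier) (δ : isDirected _⊑_ α)
              → isSup _⊑_ α (∐ α δ)

    _≪_ : Carrier → Carrier → Set (lsuc 𝓥 ⊔ 𝓤 ⊔ 𝓣)
    x ≪ y = (I : Set 𝓥) (α : I → Carrier) (δ : isDirected _⊑_ α)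
          → y ⊑ ∐ α δ → ∥ Σ I (λ i → x ⊑ α i) ∥

  open DCPO

  record SmallBasis {𝓥 𝓤 𝓣 : Level} (D : DCPO 𝓥 𝓤 𝓣) : Set (lsuc 𝓥 ⊔ 𝓤 ⊔ 𝓣) where
    field
      B : Set 𝓥
      β : B → Carrier D
      ≪-small : (b : B) (x : Carrier D) → isSmall 𝓥 (_≪_ D (β b) x)
      ↡-directed : (x : Carrier D)
                 → isDirected (_⊑_ D) (λ (p : Σ B (λ b → _≪_ D (β b) x)) → β (proj₁ p))
      ↡-sup : (x : Carrier D)
            → isSup (_⊑_ D) (λ (p : Σ B (λ b → _≪_ D (β b) x)) → β (proj₁ p)) x

  hasSmallSups : {𝓥 𝓤 𝓣 : Level} → DCPO 𝓥 𝓤 𝓣 → Set (lsuc 𝓥 ⊔ 𝓤 ⊔ 𝓣)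
  hasSmallSups {𝓥} E = (I : Set 𝓥) (α : I → Carrier E) → Σ (Carrier E) (isSup (_⊑_ E) α)

  isContinuous : {𝓥 𝓤 𝓣 𝓤' 𝓣' : Level} (D : DCPO 𝓥 𝓤 𝓣) (E : DCPO 𝓥 𝓤' 𝓣')
               → (Carrier D → Carrier E) → Set (lsuc 𝓥 ⊔ 𝓤 ⊔ 𝓣 ⊔ 𝓤' ⊔ 𝓣')
  isContinuous {𝓥} D E f =
    (I : Set 𝓥) (α : I → Carrier D) (δ : isDirected (_⊑_ D) α)
    → isSup (_⊑_ E) (λ i → f (α i)) (f (∐ D α δ))

  isSup-prop : FunExt → ∀ {𝓤 𝓣 i} {X : Set 𝓤} (_⊑_ : X → X → Set 𝓣)
             → (∀ x y → isProp (x ⊑ y)) → {I : Set i} (α : I → X) (s : X)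
             → isProp (isSup _⊑_ α s)
  isSup-prop fe _⊑_ p α s =
    isProp-× (isProp-Π fe (λ i → p (α i) s))
             (isProp-Π fe (λ u → isProp-Π fe (λ _ → p s u)))

  isContinuous-prop : FunExt → {𝓥 𝓤 𝓣 𝓤' 𝓣' : Level} (D : DCPO 𝓥 𝓤 𝓣) (E : DCPO 𝓥 𝓤' 𝓣')
                    → (f : Carrier D → Carrier E) → isProp (isContinuous D E f)
  isContinuous-prop fe D E f =
    isProp-Π fe (λ I → isProp-Π fe (λ α → isProp-Π fe (λ δ →
      isSup-prop fe (_⊑_ E) (⊑-prop E) (λ i → f (α i)) (f (∐ D α δ)))))

  Exponential : FunExt → {𝓥 𝓤 𝓣 𝓤' 𝓣' : Level} (D : DCPO 𝓥 𝓤 𝓣) (E : DCPO 𝓥 𝓤' 𝓣')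
              → DCPO 𝓥 (lsuc 𝓥 ⊔ 𝓤 ⊔ 𝓣 ⊔ 𝓤' ⊔ 𝓣') (𝓤 ⊔ 𝓣')
  Exponential fe {𝓥} D E = record
    { Carrier = Σ (Carrier D → Carrier E) (isContinuous D E)
    ; _⊑_ = _≤_
    ; ⊑-prop = λ f g → isProp-Π fe (λ x → ⊑-prop E (proj₁ f x) (proj₁ g x))
    ; ⊑-refl = λ f x → ⊑-refl E (proj₁ f x)
    ; ⊑-trans = λ p q x → ⊑-trans E (p x) (q x)
    ; ⊑-antisym = λ {f} {g} p q →
        Σ-≡ (fe (λ x → ⊑-antisym E (p x) (q x)))
            (isContinuous-prop fe D E (proj₁ g) _ _)
    ; ∐ = sup
    ; ∐-isSup = λ φ δ →
        (λ i x → proj₁ (∐-isSup E (λ j → proj₁ (φ j) x) (ptw φ δ x)) i)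
      , (λ u ub x → proj₂ (∐-isSup E (λ j → proj₁ (φ j) x) (ptw φ δ x)) (proj₁ u x) (λ j → ub j x))
    }
    where
      C = Σ (Carrier D → Carrier E) (isContinuous D E)
      _≤_ : C → C → Set _
      f ≤ g = (x : Carrier D) → _⊑_ E (proj₁ f x) (proj₁ g x)

      ptw : {I : Set 𝓥} (φ : I → C) → isDirected _≤_ φ → (x : Carrier D)
          → isDirected (_⊑_ E) (λ j → proj₁ (φ j) x)
      ptw φ δ x = proj₁ δ
                , (λ i j → ∥∥-map (λ { (k , p , q) → k , p x , q x }) (proj₂ δ i j))

      sup : {I : Set 𝓥} (φ : I → C) → isDirected _≤_ φ → C
      sup {I} φ δ = g , cont
        where
          g : Carrier D → Carrier E
          g x = ∐ E (λ j → proj₁ (φ j) x) (ptw φ δ x)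
          gsup : (x : Carrier D) → isSup (_⊑_ E) (λ j → proj₁ (φ j) x) (g x)
          gsup x = ∐-isSup E (λ j → proj₁ (φ j) x) (ptw φ δ x)
          cont : isContinuous D E g
          cont J α ε =
              (λ i → proj₂ (gsup (α i)) (g (∐ D α ε))
                       (λ j → ⊑-trans E (proj₁ (proj₂ (φ j) J α ε) i)
                                        (proj₁ (gsup (∐ D α ε)) j)))
            , (λ u ub → proj₂ (gsup (∐ D α ε)) u
                 (λ j → proj₂ (proj₂ (φ j) J α ε) u
                    (λ i → ⊑-trans E (proj₁ (gsup (α i)) j) (ub i))))

-- The basis of E^D consists of finite joins of step functions (d ⇒ e), where (d ⇒ e) x is
-- β e if β d ≪ x and ⊥ otherwise; the small sups of E make these joins exist.  A step
-- (d ⇒ e) is way below g whenever β e ≪ g (β d), every continuous g is the directed join of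
-- the finite joins of such steps, and since both sides of "l ≪ g" are then determined by
-- values on the basis of D, the proposition l ≪ g is equivalent to a 𝓥-small one.
module Submission where

open import Defs
open import Level using (Level; Lift; lift)
open import Data.Bool using (Bool; true; false)
open import Data.Unit.Polymorphic using (⊤; tt)
open import Data.Empty.Polymorphic using (⊥)
open import Data.Product using (Σ; _×_; _,_; proj₁; proj₂)
open import Data.List using (List; []; _∷_; _++_)
open import Data.List.Relation.Unary.All using (All; []; _∷_)
open import Data.List.Relation.Unary.All.Properties using (++⁺)
open import Relation.Binary.PropositionalEquality using (_≡_; subst; sym)

≃-fromProps : ∀ {a b} {P : Set a} {Q : Set b}
            → isProp P → isProp Q → (P → Q) → (Q → P) → P ≃ Q
≃-fromProps pP pQ f g =
  f , record { sec = g ; sec-eq = λ _ → pQ _ _ ; ret = g ; ret-eq = λ _ → pP _ _ }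

pair : ∀ {a ℓ} {A : Set a} → A → A → Lift ℓ Bool → A
pair x y (lift false) = x
pair x y (lift true)  = y

module _ (pt : PropTrunc) (fe : FunExt) where
  open PropTrunc pt
  open DomainTheory pt

  module DCPOProperties {𝓥 𝓤 𝓣 : Level} (X : DCPO 𝓥 𝓤 𝓣) where
    open DCPO X

    ∐-upper : {I : Set 𝓥} (α : I → Carrier) (δ : isDirected _⊑_ α) (i : I) → α i ⊑ ∐ α δ
    ∐-upper α δ = proj₁ (∐-isSup α δ)

    ∐-least : {I : Set 𝓥} (α : I → Carrier) (δ : isDirected _⊑_ α) {u : Carrier}
            → isUpperBound _⊑_ α u → ∐ α δ ⊑ u
    ∐-least α δ = proj₂ (∐-isSup α δ) _

    ∐-≡-sup : {I : Set 𝓥} (α : I → Carrier) (δ : isDirected _⊑_ α) {s : Carrier}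
            → isSup _⊑_ α s → ∐ α δ ≡ s
    ∐-≡-sup α δ (s-upper , s-least) = ⊑-antisym (∐-least α δ s-upper) (s-least _ (∐-upper α δ))

    ≪-prop : (x y : Carrier) → isProp (x ≪ y)
    ≪-prop x y = isProp-Π fe λ _ → isProp-Π fe λ _ → isProp-Π fe λ _ → isProp-Π fe λ _ → ∥∥-isProp

    ≪-⊑-trans : {a b c : Carrier} → a ≪ b → b ⊑ c → a ≪ c
    ≪-⊑-trans a≪b b⊑c I α δ c⊑∐ = a≪b I α δ (⊑-trans b⊑c c⊑∐)

    ⊑-≪-trans : {a b c : Carrier} → a ⊑ b → b ≪ c → a ≪ c
    ⊑-≪-trans a⊑b b≪c I α δ c⊑∐ = ∥∥-map (λ (i , b⊑αi) → i , ⊑-trans a⊑b b⊑αi) (b≪c I α δ c⊑∐)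

    pair-directed : {x y : Carrier} → x ⊑ y → isDirected _⊑_ (pair {ℓ = 𝓥} x y)
    pair-directed {x} {y} x⊑y = ∣ lift true ∣ , λ i j → ∣ lift true , below i , below j ∣
      where
        below : (i : Lift 𝓥 Bool) → pair x y i ⊑ y
        below (lift false) = x⊑y
        below (lift true)  = ⊑-refl y

    ∐-pair : {x y : Carrier} (x⊑y : x ⊑ y) → ∐ (pair x y) (pair-directed x⊑y) ≡ y
    ∐-pair {x} {y} x⊑y = ∐-≡-sup _ _ (upper , λ u u-upper → u-upper (lift true))
      where
        upper : isUpperBound _⊑_ (pair {ℓ = 𝓥} x y) y
        upper (lift false) = x⊑y
        upper (lift true)  = ⊑-refl y

    ≪⇒⊑ : {a b : Carrier} → a ≪ b → a ⊑ b
    ≪⇒⊑ {a} {b} a≪b =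
      ∥∥-rec (⊑-prop a b) proj₂ (a≪b ⊤ (λ _ → b) δ (∐-upper _ δ tt))
      where
        δ : isDirected _⊑_ {I = ⊤} (λ _ → b)
        δ = ∣ tt ∣ , λ _ _ → ∣ tt , ⊑-refl b , ⊑-refl b ∣

    ≪-below-join : {a b c g : Carrier} → a ≪ g → b ≪ g
                 → ((u : Carrier) → a ⊑ u → b ⊑ u → c ⊑ u) → c ≪ g
    ≪-below-join a≪g b≪g c-below I α δ g⊑∐ =
      ∥∥-rec ∥∥-isProp (λ (i , a⊑αi) → ∥∥-rec ∥∥-isProp (λ (j , b⊑αj) →
        ∥∥-map (λ (k , αi⊑αk , αj⊑αk) → k , c-below (α k) (⊑-trans a⊑αi αi⊑αk) (⊑-trans b⊑αj αj⊑αk))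
          (proj₂ δ i j))
        (b≪g I α δ g⊑∐)) (a≪g I α δ g⊑∐)

    least-≪ : {c g : Carrier} → ((u : Carrier) → c ⊑ u) → c ≪ g
    least-≪ c-least I α δ _ = ∥∥-map (λ i → i , c-least (α i)) (proj₁ δ)

  continuous⇒monotone : {𝓥 𝓤 𝓣 𝓤' 𝓣' : Level} (X : DCPO 𝓥 𝓤 𝓣) (Y : DCPO 𝓥 𝓤' 𝓣')
                        (f : DCPO.Carrier X → DCPO.Carrier Y) → isContinuous X Y f
                      → {x y : DCPO.Carrier X} → DCPO._⊑_ X x y → DCPO._⊑_ Y (f x) (f y)
  continuous⇒monotone X Y f f-cont {x} {y} x⊑y =
    subst (λ z → DCPO._⊑_ Y (f x) (f z)) (∐-pair x⊑y)
      (proj₁ (f-cont _ (pair x y) (pair-directed x⊑y)) (lift false))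
    where open DCPOProperties X

  module BasisProperties {𝓥 𝓤 𝓣 : Level} (X : DCPO 𝓥 𝓤 𝓣) (Bs : SmallBasis X) where
    open DCPO X
    open SmallBasis Bs
    open DCPOProperties X

    _≪ₛ_ : B → Carrier → Set 𝓥
    b ≪ₛ x = proj₁ (≪-small b x)

    ≪ₛ⇒≪ : {b : B} {x : Carrier} → b ≪ₛ x → β b ≪ x
    ≪ₛ⇒≪ {b} {x} = proj₁ (proj₂ (≪-small b x))

    ≪⇒≪ₛ : {b : B} {x : Carrier} → β b ≪ x → b ≪ₛ x
    ≪⇒≪ₛ {b} {x} = isEquiv.sec (proj₂ (proj₂ (≪-small b x)))

    ↡ᴮ : Carrier → Set 𝓥
    ↡ᴮ x = Σ B (_≪ₛ x)

    ↡ι : (x : Carrier) → ↡ᴮ x → Carrier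
    ↡ι x (b , _) = β b

    ↡ᴮ-directed : (x : Carrier) → isDirected _⊑_ (↡ι x)
    ↡ᴮ-directed x =
        ∥∥-map (λ (b , b≪x) → b , ≪⇒≪ₛ b≪x) (proj₁ (↡-directed x))
      , λ (b , b≪x) (c , c≪x) →
          ∥∥-map (λ ((k , k≪x) , below) → (k , ≪⇒≪ₛ k≪x) , below)
                 (proj₂ (↡-directed x) (b , ≪ₛ⇒≪ b≪x) (c , ≪ₛ⇒≪ c≪x))

    ↡ᴮ-sup : (x : Carrier) → isSup _⊑_ (↡ι x) x
    ↡ᴮ-sup x = (λ (b , b≪x) → proj₁ (↡-sup x) (b , ≪ₛ⇒≪ b≪x))
             , λ u u-upper → proj₂ (↡-sup x) u (λ (b , b≪x) → u-upper (b , ≪⇒≪ₛ b≪x))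

    ↡ᴮ-least : {x u : Carrier} → ((b : B) → b ≪ₛ x → β b ⊑ u) → x ⊑ u
    ↡ᴮ-least {x} {u} below = proj₂ (↡ᴮ-sup x) u (λ (b , b≪x) → below b b≪x)

    ∐-↡ᴮ : (x : Carrier) → ∐ (↡ι x) (↡ᴮ-directed x) ≡ x
    ∐-↡ᴮ x = ∐-≡-sup _ _ (↡ᴮ-sup x)

    ≪-approximated : {a x : Carrier} → a ≪ x → ∥ Σ B (λ b → (b ≪ₛ x) × (a ⊑ β b)) ∥
    ≪-approximated {a} {x} a≪x =
      ∥∥-map (λ ((b , b≪x) , a⊑b) → b , b≪x , a⊑b)
        (a≪x _ (↡ι x) (↡ᴮ-directed x) (subst (x ⊑_) (sym (∐-↡ᴮ x)) (⊑-refl x)))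

    _⊑ₛ_ : Carrier → Carrier → Set 𝓥
    x ⊑ₛ y = (b : B) → b ≪ₛ x → b ≪ₛ y

    ⊑ₛ⇒⊑ : {x y : Carrier} → x ⊑ₛ y → x ⊑ y
    ⊑ₛ⇒⊑ x⊑ₛy = ↡ᴮ-least (λ b b≪x → ≪⇒⊑ (≪ₛ⇒≪ (x⊑ₛy b b≪x)))

    ⊑⇒⊑ₛ : {x y : Carrier} → x ⊑ y → x ⊑ₛ y
    ⊑⇒⊑ₛ x⊑y b b≪x = ≪⇒≪ₛ (≪-⊑-trans (≪ₛ⇒≪ b≪x) x⊑y)

    module _ (x : Carrier) where
      -- x is the directed join of all β b' with b' ≪ b ≪ x.
      private
        I : Set 𝓥
        I = Σ (↡ᴮ x) λ (b , _) → ↡ᴮ (β b)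

        α : I → Carrier
        α (_ , (b' , _)) = β b'

        inhabited : ∥ I ∥
        inhabited = ∥∥-rec ∥∥-isProp (λ (b , b≪x) → ∥∥-map ((b , b≪x) ,_) (proj₁ (↡ᴮ-directed (β b))))
                           (proj₁ (↡ᴮ-directed x))

        semidirected : isSemidirected _⊑_ α
        semidirected (i , (c₁ , c₁≪b₁)) (j , (c₂ , c₂≪b₂)) =
              ∥∥-rec ∥∥-isProp (λ ((b , b≪x) , b₁⊑b , b₂⊑b) →
                ∥∥-rec ∥∥-isProp (λ (c₁' , c₁'≪b , c₁⊑c₁') →
                  ∥∥-rec ∥∥-isProp (λ (c₂' , c₂'≪b , c₂⊑c₂') →
                    ∥∥-map (λ (k , c₁'⊑k , c₂'⊑k) →
                              ((b , b≪x) , k) , ⊑-trans c₁⊑c₁' c₁'⊑k , ⊑-trans c₂⊑c₂' c₂'⊑k)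
                      (proj₂ (↡ᴮ-directed (β b)) (c₁' , c₁'≪b) (c₂' , c₂'≪b)))
                  (≪-approximated (≪-⊑-trans (≪ₛ⇒≪ c₂≪b₂) b₂⊑b)))
                (≪-approximated (≪-⊑-trans (≪ₛ⇒≪ c₁≪b₁) b₁⊑b)))
              (proj₂ (↡ᴮ-directed x) i j)

        δ : isDirected _⊑_ α
        δ = inhabited , semidirected

        x⊑∐α : x ⊑ ∐ α δ
        x⊑∐α = ↡ᴮ-least λ b b≪x → ↡ᴮ-least λ b' b'≪b → ∐-upper α δ ((b , b≪x) , (b' , b'≪b))

      ≪-interpolation : {d : B} → β d ≪ x → ∥ Σ B (λ d' → (β d ≪ β d') × (β d' ≪ x)) ∥
      ≪-interpolation {d} d≪x =
        ∥∥-map {B = Σ B (λ d' → (β d ≪ β d') × (β d' ≪ x))}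
               (λ (((b , b≪x) , (b' , b'≪b)) , d⊑b') → b , ⊑-≪-trans d⊑b' (≪ₛ⇒≪ b'≪b) , ≪ₛ⇒≪ b≪x)
               (d≪x I α δ x⊑∐α)

    ≪-∐ : {d : B} {I : Set 𝓥} (α : I → Carrier) (δ : isDirected _⊑_ α)
        → β d ≪ ∐ α δ → ∥ Σ I (λ i → β d ≪ α i) ∥
    ≪-∐ α δ d≪∐ =
      ∥∥-rec ∥∥-isProp (λ (d' , d≪d' , d'≪∐) →
        ∥∥-map (λ (i , d'⊑αi) → i , ≪-⊑-trans d≪d' d'⊑αi) (d'≪∐ _ α δ (⊑-refl _)))
        (≪-interpolation (∐ α δ) d≪∐)

  module ContinuousOnBasis {𝓥 𝓤 𝓣 𝓤' 𝓣' : Level}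
    (X : DCPO 𝓥 𝓤 𝓣) (Bs : SmallBasis X) (Y : DCPO 𝓥 𝓤' 𝓣') where
    open SmallBasis Bs
    open BasisProperties X Bs
    module X = DCPO X
    module Y = DCPO Y

    continuous-⊑-from-basis : (f : X.Carrier → Y.Carrier) → isContinuous X Y f
                            → {x : X.Carrier} {u : Y.Carrier}
                            → ((b : B) → b ≪ₛ x → f (β b) Y.⊑ u) → f x Y.⊑ u
    continuous-⊑-from-basis f f-cont {x} {u} below =
      subst (λ z → f z Y.⊑ u) (∐-↡ᴮ x)
        (proj₂ (f-cont _ (↡ι x) (↡ᴮ-directed x)) u (λ (b , b≪x) → below b b≪x))

    continuous-⊑-on-basis : (f g : X.Carrier → Y.Carrier)
                          → isContinuous X Y f → isContinuous X Y g
                          → ((b : B) → f (β b) Y.⊑ g (β b)) → (x : X.Carrier) → f x Y.⊑ g x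
    continuous-⊑-on-basis f g f-cont g-cont f⊑g x =
      continuous-⊑-from-basis f f-cont λ b b≪x →
        Y.⊑-trans (f⊑g b) (continuous⇒monotone X Y g g-cont (DCPOProperties.≪⇒⊑ X (≪ₛ⇒≪ b≪x)))

  module StepFunctionBasis {𝓥 𝓤 𝓣 𝓤' 𝓣' : Level}
    (D : DCPO 𝓥 𝓤 𝓣) (E : DCPO 𝓥 𝓤' 𝓣')
    (BsD : SmallBasis D) (BsE : SmallBasis E) (sups : hasSmallSups E) where

    module D = DCPO D
    module E = DCPO E
    module Eᴰ = DCPO (Exponential fe D E)
    module BD = SmallBasis BsD
    module BE = SmallBasis BsE
    open BasisProperties D BsD using (_≪ₛ_; ≪ₛ⇒≪; ≪⇒≪ₛ; ≪-∐)
    open BasisProperties E BsE using () renaming (_≪ₛ_ to _≪ₑ_; ≪ₛ⇒≪ to ≪ₑ⇒≪; _⊑ₛ_ to _⊑ₑ_)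
    open ContinuousOnBasis D BsD E using (continuous-⊑-from-basis; continuous-⊑-on-basis)
    open DCPOProperties (Exponential fe D E) using (≪-prop; ⊑-≪-trans; ≪⇒⊑; ≪-below-join; least-≪)

    infix 30 _⟨_⟩
    _⟨_⟩ : Eᴰ.Carrier → D.Carrier → E.Carrier
    f ⟨ x ⟩ = proj₁ f x

    ⋁ : {I : Set 𝓥} → (I → E.Carrier) → E.Carrier
    ⋁ α = proj₁ (sups _ α)

    ⋁-upper : {I : Set 𝓥} (α : I → E.Carrier) (i : I) → α i E.⊑ ⋁ α
    ⋁-upper α = proj₁ (proj₂ (sups _ α))

    ⋁-least : {I : Set 𝓥} (α : I → E.Carrier) {u : E.Carrier}
            → isUpperBound E._⊑_ α u → ⋁ α E.⊑ u
    ⋁-least α = proj₂ (proj₂ (sups _ α)) _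

    ⊥ₑ : E.Carrier
    ⊥ₑ = ⋁ {⊥} λ ()

    ⊥ₑ-least : (u : E.Carrier) → ⊥ₑ E.⊑ u
    ⊥ₑ-least u = ⋁-least _ λ ()

    infixl 25 _∨_
    _∨_ : E.Carrier → E.Carrier → E.Carrier
    a ∨ b = ⋁ (pair {ℓ = 𝓥} a b)

    ∨-upperˡ : {a b : E.Carrier} → a E.⊑ a ∨ b
    ∨-upperˡ = ⋁-upper _ (lift false)

    ∨-upperʳ : {a b : E.Carrier} → b E.⊑ a ∨ b
    ∨-upperʳ = ⋁-upper _ (lift true)

    ∨-least : {a b u : E.Carrier} → a E.⊑ u → b E.⊑ u → a ∨ b E.⊑ u
    ∨-least {a} {b} a⊑u b⊑u = ⋁-least _ λ where
      (lift false) → a⊑u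
      (lift true)  → b⊑u

    step : BD.B → BE.B → D.Carrier → E.Carrier
    step d e x = ⋁ {d ≪ₛ x} λ _ → BE.β e

    step-upper : {d : BD.B} {e : BE.B} {x : D.Carrier} → d ≪ₛ x → BE.β e E.⊑ step d e x
    step-upper = ⋁-upper _

    step-least : {d : BD.B} {e : BE.B} {x : D.Carrier} {u : E.Carrier}
               → (d ≪ₛ x → BE.β e E.⊑ u) → step d e x E.⊑ u
    step-least = ⋁-least _

    step-continuous : (d : BD.B) (e : BE.B) → isContinuous D E (step d e)
    step-continuous d e I α δ =
        (λ i → step-least λ d≪αi →
           step-upper (≪⇒≪ₛ (DCPOProperties.≪-⊑-trans D (≪ₛ⇒≪ d≪αi) (DCPOProperties.∐-upper D α δ i))))
      , λ u u-upper → step-least λ d≪∐ →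
          ∥∥-rec (E.⊑-prop _ _) (λ (i , d≪αi) → E.⊑-trans (step-upper (≪⇒≪ₛ d≪αi)) (u-upper i))
                 (≪-∐ α δ (≪ₛ⇒≪ d≪∐))

    ⦅_⇒_⦆ : BD.B → BE.B → Eᴰ.Carrier
    ⦅ d ⇒ e ⦆ = step d e , step-continuous d e

    ⦅⇒⦆-≪ : {d : BD.B} {e : BE.B} (g : Eᴰ.Carrier) → BE.β e E.≪ g ⟨ BD.β d ⟩ → ⦅ d ⇒ e ⦆ Eᴰ.≪ g
    ⦅⇒⦆-≪ {d} g e≪gd I φ δ g⊑∐ =
      ∥∥-map (λ (j , e⊑φjd) → j , λ x → step-least λ d≪x →
                E.⊑-trans e⊑φjd (continuous⇒monotone D E _ (proj₂ (φ j)) (DCPOProperties.≪⇒⊑ D (≪ₛ⇒≪ d≪x))))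
             (e≪gd I (λ j → φ j ⟨ BD.β d ⟩) _ (g⊑∐ (BD.β d)))

    _∨ᶠ_ : Eᴰ.Carrier → Eᴰ.Carrier → Eᴰ.Carrier
    (f , f-cont) ∨ᶠ (g , g-cont) = (λ x → f x ∨ g x) , continuous
      where
        continuous : isContinuous D E (λ x → f x ∨ g x)
        continuous I α δ =
            (λ i → ∨-least (E.⊑-trans (proj₁ (f-cont I α δ) i) ∨-upperˡ)
                           (E.⊑-trans (proj₁ (g-cont I α δ) i) ∨-upperʳ))
          , λ u u-upper → ∨-least (proj₂ (f-cont I α δ) u λ i → E.⊑-trans ∨-upperˡ (u-upper i))
                                  (proj₂ (g-cont I α δ) u λ i → E.⊑-trans ∨-upperʳ (u-upper i))

    Steps : Set 𝓥
    Steps = List (BD.B × BE.B)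

    ⋁ˢ : Steps → Eᴰ.Carrier
    ⋁ˢ []            = (λ _ → ⊥ₑ) , λ _ _ _ → (λ _ → E.⊑-refl ⊥ₑ) , λ u _ → ⊥ₑ-least u
    ⋁ˢ ((d , e) ∷ l) = ⦅ d ⇒ e ⦆ ∨ᶠ ⋁ˢ l

    ⋁ˢ-++-upperˡ : (l m : Steps) → ⋁ˢ l Eᴰ.⊑ ⋁ˢ (l ++ m)
    ⋁ˢ-++-upperˡ []      m x = ⊥ₑ-least _
    ⋁ˢ-++-upperˡ (_ ∷ l) m x = ∨-least ∨-upperˡ (E.⊑-trans (⋁ˢ-++-upperˡ l m x) ∨-upperʳ)

    ⋁ˢ-++-upperʳ : (l m : Steps) → ⋁ˢ m Eᴰ.⊑ ⋁ˢ (l ++ m)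
    ⋁ˢ-++-upperʳ []      m x = E.⊑-refl _
    ⋁ˢ-++-upperʳ (_ ∷ l) m x = E.⊑-trans (⋁ˢ-++-upperʳ l m x) ∨-upperʳ

    ⋁ˢ-++-least : (l m : Steps) {u : Eᴰ.Carrier} → ⋁ˢ l Eᴰ.⊑ u → ⋁ˢ m Eᴰ.⊑ u → ⋁ˢ (l ++ m) Eᴰ.⊑ u
    ⋁ˢ-++-least []      m l⊑u m⊑u = m⊑u
    ⋁ˢ-++-least (_ ∷ l) m {u} l⊑u m⊑u x =
      ∨-least (E.⊑-trans ∨-upperˡ (l⊑u x))
              (⋁ˢ-++-least l m {u} (λ y → E.⊑-trans ∨-upperʳ (l⊑u y)) m⊑u x)

    ⋁ˢ-singleton-upper : {d : BD.B} {e : BE.B} {x : D.Carrier}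
                       → d ≪ₛ x → BE.β e E.⊑ ⋁ˢ ((d , e) ∷ []) ⟨ x ⟩
    ⋁ˢ-singleton-upper d≪x = E.⊑-trans (step-upper d≪x) ∨-upperˡ

    ⋁ˢ-++-≪ : (l m : Steps) {g : Eᴰ.Carrier} → ⋁ˢ l Eᴰ.≪ g → ⋁ˢ m Eᴰ.≪ g → ⋁ˢ (l ++ m) Eᴰ.≪ g
    ⋁ˢ-++-≪ l m {g} l≪g m≪g =
      ≪-below-join {⋁ˢ l} {⋁ˢ m} {⋁ˢ (l ++ m)} {g} l≪g m≪g λ u → ⋁ˢ-++-least l m {u}

    StepsBelow : Eᴰ.Carrier → Steps → Set 𝓥
    StepsBelow g = All λ (d , e) → e ≪ₑ g ⟨ BD.β d ⟩

    StepsBelow⇒≪ : (g : Eᴰ.Carrier) (l : Steps) → StepsBelow g l → ⋁ˢ l Eᴰ.≪ g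
    StepsBelow⇒≪ g []            []           = least-≪ {⋁ˢ []} {g} λ _ _ → ⊥ₑ-least _
    StepsBelow⇒≪ g ((d , e) ∷ l) (e≪gd ∷ below) =
      ≪-below-join {⦅ d ⇒ e ⦆} {⋁ˢ l} {⋁ˢ ((d , e) ∷ l)} {g}
        (⦅⇒⦆-≪ g (≪ₑ⇒≪ e≪gd)) (StepsBelow⇒≪ g l below) λ _ d⇒e⊑u l⊑u x → ∨-least (d⇒e⊑u x) (l⊑u x)

    ⊑-from-steps : (g u : Eᴰ.Carrier)
                 → ((d : BD.B) (e : BE.B) → e ≪ₑ g ⟨ BD.β d ⟩ → ⋁ˢ ((d , e) ∷ []) Eᴰ.⊑ u)
                 → g Eᴰ.⊑ u
    ⊑-from-steps g u below x = continuous-⊑-from-basis (proj₁ g) (proj₂ g) λ d d≪x →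
      BasisProperties.↡ᴮ-least E BsE λ e e≪gd → E.⊑-trans (⋁ˢ-singleton-upper d≪x) (below d e e≪gd x)

    ↡ˢ : Eᴰ.Carrier → Set 𝓥
    ↡ˢ g = Σ Steps (StepsBelow g)

    ↡ˢ-family : (g : Eᴰ.Carrier) → ↡ˢ g → Eᴰ.Carrier
    ↡ˢ-family g (l , _) = ⋁ˢ l

    ↡ˢ-directed : (g : Eᴰ.Carrier) → isDirected Eᴰ._⊑_ (↡ˢ-family g)
    ↡ˢ-directed g = ∣ [] , [] ∣
      , λ (l , l-below) (m , m-below) →
          ∣ (l ++ m , ++⁺ l-below m-below) , ⋁ˢ-++-upperˡ l m , ⋁ˢ-++-upperʳ l m ∣

    ⊑-∐-↡ˢ : (g : Eᴰ.Carrier) → g Eᴰ.⊑ Eᴰ.∐ (↡ˢ-family g) (↡ˢ-directed g)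
    ⊑-∐-↡ˢ g = ⊑-from-steps g (Eᴰ.∐ (↡ˢ-family g) (↡ˢ-directed g)) λ d e e≪gd →
      DCPOProperties.∐-upper (Exponential fe D E) (↡ˢ-family g) (↡ˢ-directed g) ((d , e) ∷ [] , e≪gd ∷ [])

    -- Unlike ⋁ˢ l ⊑ ⋁ˢ m, comparing the values on the basis of D by ⊑ₑ is a 𝓥-small condition.
    _≪ˢ_ : Steps → Eᴰ.Carrier → Set 𝓥
    l ≪ˢ g = ∥ Σ (↡ˢ g) (λ (m , _) → (d : BD.B) → ⋁ˢ l ⟨ BD.β d ⟩ ⊑ₑ ⋁ˢ m ⟨ BD.β d ⟩) ∥

    ≪ˢ⇒≪ : (l : Steps) (g : Eᴰ.Carrier) → l ≪ˢ g → ⋁ˢ l Eᴰ.≪ g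
    ≪ˢ⇒≪ l g = ∥∥-rec (≪-prop (⋁ˢ l) g) λ ((m , m-below) , l⊑m) →
      ⊑-≪-trans {⋁ˢ l} {⋁ˢ m} {g}
        (continuous-⊑-on-basis _ _ (proj₂ (⋁ˢ l)) (proj₂ (⋁ˢ m)) λ d → BasisProperties.⊑ₛ⇒⊑ E BsE (l⊑m d))
        (StepsBelow⇒≪ g m m-below)

    ≪⇒≪ˢ : (l : Steps) (g : Eᴰ.Carrier) → ⋁ˢ l Eᴰ.≪ g → l ≪ˢ g
    ≪⇒≪ˢ l g l≪g = ∥∥-map (λ (i , l⊑m) → i , λ d → BasisProperties.⊑⇒⊑ₛ E BsE (l⊑m (BD.β d)))
                          (l≪g _ (↡ˢ-family g) (↡ˢ-directed g) (⊑-∐-↡ˢ g))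

    ⋁ˢ-≪-directed : (g : Eᴰ.Carrier)
                  → isDirected Eᴰ._⊑_ (λ (p : Σ Steps (λ l → ⋁ˢ l Eᴰ.≪ g)) → ⋁ˢ (proj₁ p))
    ⋁ˢ-≪-directed g = ∣ [] , StepsBelow⇒≪ g [] [] ∣
      , λ (l , l≪g) (m , m≪g) →
          ∣ (l ++ m , ⋁ˢ-++-≪ l m {g} l≪g m≪g) , ⋁ˢ-++-upperˡ l m , ⋁ˢ-++-upperʳ l m ∣

    exponentialBasis : SmallBasis (Exponential fe D E)
    exponentialBasis = record
      { B = Steps
      ; β = ⋁ˢ
      ; ≪-small = λ l g → l ≪ˢ g , ≃-fromProps ∥∥-isProp (≪-prop (⋁ˢ l) g) (≪ˢ⇒≪ l g) (≪⇒≪ˢ l g)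
      ; ↡-directed = ⋁ˢ-≪-directed
      ; ↡-sup = λ g → (λ (l , l≪g) → ≪⇒⊑ {⋁ˢ l} {g} l≪g)
                    , λ u u-upper → ⊑-from-steps g u λ d e e≪gd →
                        u-upper ((d , e) ∷ [] , StepsBelow⇒≪ g _ (e≪gd ∷ []))
      }

mainTheorem14 : (pt : PropTrunc) (fe : FunExt) (pe : PropExt)
                {𝓥 𝓤 𝓣 𝓤' 𝓣' : Level}
                (D : DomainTheory.DCPO pt 𝓥 𝓤 𝓣) (E : DomainTheory.DCPO pt 𝓥 𝓤' 𝓣')
              → DomainTheory.SmallBasis pt D
              → DomainTheory.SmallBasis pt E
              → DomainTheory.hasSmallSups pt E
              → DomainTheory.SmallBasis pt (DomainTheory.Exponential pt fe D E)
mainTheorem14 pt fe pe D E BsD BsE sups = StepFunctionBasis.exponentialBasis pt fe D E BsD BsE sups
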